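{- Let $M$ be a matroid of rank $4$ and let $A=\{a_1,a_2,a_3,a_4\}$ and $B=\{b_1,b_2,b_3,b_4\}$ be two disjoint bases of $M$. Suppose that $A-a_1+b_1$, $B-b_1+a_1$, $\{b_1,b_2,a_3,a_4\}$ and $\{a_1,a_2,b_3,b_4\}$ are all bases (i.e. $\{a_1,a_2\}$ and $\{b_1,b_2\}$ form a serial symmetric exchange relative to $A$ and $B$). Let $a'\in A\setminus\{a_1,a_2\}$ and $b'\in B\setminus\{b_1,b_2\}$, and suppose $A-a'+b'$ and $B-b'+a'$ are both bases. Then $(A,B)$ is a serial symmetric exchange relative to $A$ and $B$: there exist orderings $A=\{x_1\prec x_2\prec x_3\prec x_4\}$ and $B=\{y_1\prec y_2\prec y_3\prec y_4\}$ such that for every $i=1,\dots,4$ both $(A\setminus\{x_1,\dots,x_i\})\cup\{y_1,\dots,y_i\}$ and $(B\setminus\{y_1,\dots,y_i\})\cup\{x_1,\dots,x_i\}$ are bases.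
   Context: Notation: $X+x=X\cup\{x\}$, $X-x=X\setminus\{x\}$. -}

module Defs where

open import Data.Nat using (ℕ; suc)
open import Data.Fin using (Fin; toℕ)
open import Data.Fin.Subset using (Subset; _∈_; _∉_; _∪_; _∩_; ∁; ⁅_⁆; ⊥; ∣_∣)
open import Data.List using (List; foldr; map; take; allFin)
open import Data.Product using (Σ; ∃; _×_)
open import Relation.Binary.PropositionalEquality using (_≡_)

_-_+_ : ∀ {n} → Subset n → Fin n → Fin n → Subset n
X - x + y = (X ∩ ∁ ⁅ x ⁆) ∪ ⁅ y ⁆

fromList : ∀ {n} → List (Fin n) → Subset n
fromList = foldr (λ x S → ⁅ x ⁆ ∪ S) ⊥

firstK : ∀ {m n} → (Fin m → Fin n) → ℕ → Subset n
firstK f k = fromList (map f (take k (allFin _)))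

image : ∀ {m n} → (Fin m → Fin n) → Subset n
image f = fromList (map f (allFin _))

record Matroid (n : ℕ) : Set₁ where
  field
    IsBase   : Subset n → Set
    base-∃   : ∃ IsBase
    exchange : ∀ B₁ B₂ → IsBase B₁ → IsBase B₂ → ∀ x → x ∈ B₁ → x ∉ B₂ →
               ∃ λ y → y ∈ B₂ × y ∉ B₁ × IsBase (B₁ - x + y)

HasRank : ∀ {n} → Matroid n → ℕ → Set
HasRank M r = ∀ B → Matroid.IsBase M B → ∣ B ∣ ≡ r

-- Order A as a₁, a₂, a″, a′ and B as b₁, b₂, b″, b′, where a″ and b″ are the
-- remaining elements. The four prefix exchanges are then A - a₁ + b₁,
-- {b₁, b₂, a₃, a₄}, B - b′ + a′ and B (and symmetrically for B), all bases by
-- hypothesis.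
--
-- The set identities behind this are finite bookkeeping. Every set involved is a
-- Boolean combination of the singletons {aₜ} and {bₜ}, hence the preimage, under
-- the map sending the aₜ and bₜ to eight distinct points and everything else to a
-- ninth, of the same combination on a 9-point set, where the identities hold by
-- computation.
module Submission where

open import Defs
open import Data.Bool using (Bool; false; not; _∧_; _∨_)
open import Data.Empty using (⊥-elim)
open import Data.Fin using (Fin; zero; suc; toℕ; splitAt; join; _↑ˡ_; _↑ʳ_)
open import Data.Fin.Patterns using (0F; 1F; 2F; 3F)
open import Data.Fin.Permutation using (Permutation′; _⟨$⟩ʳ_; transpose)
open import Data.Fin.Properties using (_≟_; any?; suc-injective; join-splitAt; splitAt-↑ˡ; splitAt-↑ʳ)
open import Data.Fin.Subset using (Subset; _∪_; _∩_; ∁; ⁅_⁆; ⊥)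
import Data.List as List
open import Data.Nat using (ℕ; suc)
open import Data.Product using (∃₂; _×_; _,_)
import Data.Product as Product
open import Data.Sum using (_⊎_; inj₁; inj₂; [_,_]′)
open import Data.Vec using (Vec; lookup; tabulate; zipWith; map)
open import Data.Vec.Properties
  using (lookup∘tabulate; tabulate∘lookup; tabulate-cong; lookup-zipWith; lookup-map; lookup-replicate)
open import Function using (_∘_; _⇔_; mk⇔)
open import Function.Definitions using (Injective)
open import Relation.Binary.PropositionalEquality
  using (_≡_; _≢_; refl; sym; trans; cong; cong₂; subst; module ≡-Reasoning)
open import Relation.Nullary.Decidable using (yes; no; does; does-⇔)

open ≡-Reasoning

lookup-ext : ∀ {A : Set} {n} {xs ys : Vec A n} → (∀ i → lookup xs i ≡ lookup ys i) → xs ≡ ys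
lookup-ext {xs = xs} {ys} eq = begin
  xs                   ≡⟨ tabulate∘lookup xs ⟨
  tabulate (lookup xs) ≡⟨ tabulate-cong eq ⟩
  tabulate (lookup ys) ≡⟨ tabulate∘lookup ys ⟩
  ys                   ∎

lookup-⁅⁆ : ∀ {n} (y x : Fin n) → lookup ⁅ y ⁆ x ≡ does (x ≟ y)
lookup-⁅⁆ zero    zero    = refl
lookup-⁅⁆ zero    (suc x) = lookup-replicate x false
lookup-⁅⁆ (suc y) zero    = refl
lookup-⁅⁆ (suc y) (suc x) = lookup-⁅⁆ y x

[,]∘splitAt-injective : ∀ {m n} {A : Set} (a : Fin m → A) (b : Fin n → A) →
  Injective _≡_ _≡_ a → Injective _≡_ _≡_ b → (∀ i j → a i ≢ b j) →
  Injective _≡_ _≡_ ([ a , b ]′ ∘ splitAt m)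
[,]∘splitAt-injective {m} {n} a b a-inj b-inj a≢b {x} {y} eq = begin
  x                      ≡⟨ join-splitAt m n x ⟨
  join m n (splitAt m x) ≡⟨ cong (join m n) (sum-injective (splitAt m x) (splitAt m y) eq) ⟩
  join m n (splitAt m y) ≡⟨ join-splitAt m n y ⟩
  y                      ∎
  where
  sum-injective : ∀ s t → [ a , b ]′ s ≡ [ a , b ]′ t → s ≡ t
  sum-injective (inj₁ i) (inj₁ i′) e = cong inj₁ (a-inj e)
  sum-injective (inj₁ i) (inj₂ j)  e = ⊥-elim (a≢b i j e)
  sum-injective (inj₂ j) (inj₁ i)  e = ⊥-elim (a≢b i j (sym e))
  sum-injective (inj₂ j) (inj₂ j′) e = cong inj₂ (b-inj e)

preimage : ∀ {m n} → (Fin n → Fin m) → Subset m → Subset n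
preimage f S = tabulate (lookup S ∘ f)

swapPrefix : ∀ {p n} (a b : Fin p → Fin n) (σ τ : Permutation′ p) → ℕ → Subset n
swapPrefix a b σ τ k = (image a ∩ ∁ (firstK (a ∘ (σ ⟨$⟩ʳ_)) k)) ∪ firstK (b ∘ (τ ⟨$⟩ʳ_)) k

SerialExchange : ∀ {n} → (Subset n → Set) → (a b : Fin 4 → Fin n) (σ τ : Permutation′ 4) → Set
SerialExchange Base a b σ τ = ∀ (k : Fin 4) →
  Base (swapPrefix a b σ τ (suc (toℕ k))) × Base (swapPrefix b a τ σ (suc (toℕ k)))

module Preimage {m n} (f : Fin n → Fin m) where

  infix 4 _≐_
  record _≐_ (S : Subset n) (S′ : Subset m) : Set where
    constructor mk≐
    field ≐⇒≡ : S ≡ preimage f S′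
  open _≐_ public

  -- x is the only point mapped to x′
  infix 4 _≐ₚ_
  record _≐ₚ_ (x : Fin n) (x′ : Fin m) : Set where
    constructor mk≐ₚ
    field ⁅⁆-≐ : ⁅ x ⁆ ≐ ⁅ x′ ⁆
  open _≐ₚ_ public

  ⊥-≐ : ⊥ ≐ ⊥
  ⊥-≐ = mk≐ (lookup-ext λ x → trans (lookup-replicate x _)
    (sym (trans (lookup∘tabulate _ x) (lookup-replicate (f x) _))))

  zipWith-≐ : ∀ (op : Bool → Bool → Bool) {S S′ T T′} → S ≐ S′ → T ≐ T′ →
              zipWith op S T ≐ zipWith op S′ T′
  zipWith-≐ op {S′ = S′} {T′ = T′} (mk≐ refl) (mk≐ refl) = mk≐ (lookup-ext λ x → begin
    lookup (zipWith op (preimage f S′) (preimage f T′)) x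
      ≡⟨ lookup-zipWith op x (preimage f S′) (preimage f T′) ⟩
    op (lookup (preimage f S′) x) (lookup (preimage f T′) x)
      ≡⟨ cong₂ op (lookup∘tabulate _ x) (lookup∘tabulate _ x) ⟩
    op (lookup S′ (f x)) (lookup T′ (f x))
      ≡⟨ lookup-zipWith op (f x) S′ T′ ⟨
    lookup (zipWith op S′ T′) (f x)
      ≡⟨ lookup∘tabulate _ x ⟨
    lookup (preimage f (zipWith op S′ T′)) x ∎)

  ∪-≐ : ∀ {S S′ T T′} → S ≐ S′ → T ≐ T′ → S ∪ T ≐ S′ ∪ T′
  ∪-≐ = zipWith-≐ _∨_

  ∩-≐ : ∀ {S S′ T T′} → S ≐ S′ → T ≐ T′ → S ∩ T ≐ S′ ∩ T′
  ∩-≐ = zipWith-≐ _∧_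

  ∁-≐ : ∀ {S S′} → S ≐ S′ → ∁ S ≐ ∁ S′
  ∁-≐ {S′ = S′} (mk≐ refl) = mk≐ (lookup-ext λ x → begin
    lookup (map not (preimage f S′)) x ≡⟨ lookup-map x not (preimage f S′) ⟩
    not (lookup (preimage f S′) x)    ≡⟨ cong not (lookup∘tabulate _ x) ⟩
    not (lookup S′ (f x))             ≡⟨ lookup-map (f x) not S′ ⟨
    lookup (map not S′) (f x)         ≡⟨ lookup∘tabulate _ x ⟨
    lookup (preimage f (map not S′)) x ∎)

  module _ {p} {u : Fin p → Fin n} {v : Fin p → Fin m} (u≐v : ∀ t → u t ≐ₚ v t) where

    fromList-≐ : ∀ ts → fromList (List.map u ts) ≐ fromList (List.map v ts)
    fromList-≐ List.[]       = ⊥-≐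
    fromList-≐ (t List.∷ ts) = ∪-≐ (⁅⁆-≐ (u≐v t)) (fromList-≐ ts)

    image-≐ : image u ≐ image v
    image-≐ = fromList-≐ (List.allFin p)

    firstK-≐ : ∀ k → firstK u k ≐ firstK v k
    firstK-≐ k = fromList-≐ (List.take k (List.allFin p))

  -+-≐ : ∀ {X X′ x x′ y y′} → X ≐ X′ → x ≐ₚ x′ → y ≐ₚ y′ → X - x + y ≐ X′ - x′ + y′
  -+-≐ X≐ x≐ y≐ = ∪-≐ (∩-≐ X≐ (∁-≐ (⁅⁆-≐ x≐))) (⁅⁆-≐ y≐)

  swapPrefix-≐ : ∀ {p} {a b : Fin p → Fin n} {a′ b′ : Fin p → Fin m} →
    (∀ t → a t ≐ₚ a′ t) → (∀ t → b t ≐ₚ b′ t) →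
    ∀ σ τ k → swapPrefix a b σ τ k ≐ swapPrefix a′ b′ σ τ k
  swapPrefix-≐ a≐ b≐ σ τ k =
    ∪-≐ (∩-≐ (image-≐ a≐) (∁-≐ (firstK-≐ (a≐ ∘ (σ ⟨$⟩ʳ_)) k))) (firstK-≐ (b≐ ∘ (τ ⟨$⟩ʳ_)) k)

module Classify {k n} (g : Fin k → Fin n) (g-injective : Injective _≡_ _≡_ g) where

  classify : Fin n → Fin (suc k)
  classify x with any? (λ y → g y ≟ x)
  ... | yes (y , _) = suc y
  ... | no _        = zero

  open Preimage classify

  ≡g⇔classify≡suc : ∀ x y → x ≡ g y ⇔ classify x ≡ suc y
  ≡g⇔classify≡suc x y with any? (λ z → g z ≟ x)
  ... | yes (z , refl) = mk⇔ (cong suc ∘ g-injective) (cong g ∘ suc-injective)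
  ... | no  ∄z         = mk⇔ (λ x≡gy → ⊥-elim (∄z (y , sym x≡gy))) λ ()

  g≐ₚsuc : ∀ y → g y ≐ₚ suc y
  g≐ₚsuc y = mk≐ₚ (mk≐ (lookup-ext λ x → begin
    lookup ⁅ g y ⁆ x                        ≡⟨ lookup-⁅⁆ (g y) x ⟩
    does (x ≟ g y)                          ≡⟨ does-⇔ (≡g⇔classify≡suc x y) (x ≟ g y) (classify x ≟ suc y) ⟩
    does (classify x ≟ suc y)               ≡⟨ lookup-⁅⁆ (suc y) (classify x) ⟨
    lookup ⁅ suc y ⁆ (classify x)           ≡⟨ lookup∘tabulate _ x ⟨
    lookup (preimage classify ⁅ suc y ⁆) x  ∎))

-- Point 0 of the model stands for everything outside A ∪ B.
α β : Fin 4 → Fin 9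
α t = suc (t ↑ˡ 4)
β t = suc (4 ↑ʳ t)

fin4-cases : ∀ {P : Fin 4 → Set} → P 0F → P 1F → P 2F → P 3F → ∀ k → P k
fin4-cases p₀ p₁ p₂ p₃ 0F = p₀
fin4-cases p₀ p₁ p₂ p₃ 1F = p₁
fin4-cases p₀ p₁ p₂ p₃ 2F = p₂
fin4-cases p₀ p₁ p₂ p₃ 3F = p₃

serialExchange-model : (Base : Subset 9 → Set) →
  Base (image α) → Base (image β) →
  Base (image α - α 0F + β 0F) → Base (image β - β 0F + α 0F) →
  Base (firstK β 2 ∪ (image α ∩ ∁ (firstK α 2))) →
  Base (firstK α 2 ∪ (image β ∩ ∁ (firstK β 2))) →
  ∀ {i j} → i ≡ 2F ⊎ i ≡ 3F → j ≡ 2F ⊎ j ≡ 3F →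
  Base (image α - α i + β j) → Base (image β - β j + α i) →
  SerialExchange Base α β (transpose i 3F) (transpose j 3F)
-- Once i and j are fixed, every set here is a closed vector, and each step has
-- the same normal form as the hypothesis supplied for it.
serialExchange-model _ hA hB h₁ h₂ h₃ h₄ (inj₁ refl) (inj₁ refl) h₅ h₆ =
  fin4-cases (h₁ , h₂) (h₃ , h₄) (h₆ , h₅) (hB , hA)
serialExchange-model _ hA hB h₁ h₂ h₃ h₄ (inj₁ refl) (inj₂ refl) h₅ h₆ =
  fin4-cases (h₁ , h₂) (h₃ , h₄) (h₆ , h₅) (hB , hA)
serialExchange-model _ hA hB h₁ h₂ h₃ h₄ (inj₂ refl) (inj₁ refl) h₅ h₆ =
  fin4-cases (h₁ , h₂) (h₃ , h₄) (h₆ , h₅) (hB , hA)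
serialExchange-model _ hA hB h₁ h₂ h₃ h₄ (inj₂ refl) (inj₂ refl) h₅ h₆ =
  fin4-cases (h₁ , h₂) (h₃ , h₄) (h₆ , h₅) (hB , hA)

proposition4p1 : ∀ {n} (M : Matroid n) → HasRank M 4 →
  (a b : Fin 4 → Fin n) → Injective _≡_ _≡_ a → Injective _≡_ _≡_ b →
  (∀ i j → a i ≢ b j) →
  Matroid.IsBase M (image a) → Matroid.IsBase M (image b) →
  Matroid.IsBase M (image a - a zero + b zero) →
  Matroid.IsBase M (image b - b zero + a zero) →
  Matroid.IsBase M (firstK b 2 ∪ (image a ∩ ∁ (firstK a 2))) →
  Matroid.IsBase M (firstK a 2 ∪ (image b ∩ ∁ (firstK b 2))) →
  (i j : Fin 4) → (i ≡ suc (suc zero) ⊎ i ≡ suc (suc (suc zero))) →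
  (j ≡ suc (suc zero) ⊎ j ≡ suc (suc (suc zero))) →
  Matroid.IsBase M (image a - a i + b j) →
  Matroid.IsBase M (image b - b j + a i) →
  ∃₂ λ (σ τ : Permutation′ 4) → ∀ (k : Fin 4) →
    Matroid.IsBase M ((image a ∩ ∁ (firstK (λ t → a (σ ⟨$⟩ʳ t)) (suc (toℕ k))))
                      ∪ firstK (λ t → b (τ ⟨$⟩ʳ t)) (suc (toℕ k)))
    × Matroid.IsBase M ((image b ∩ ∁ (firstK (λ t → b (τ ⟨$⟩ʳ t)) (suc (toℕ k))))
                      ∪ firstK (λ t → a (σ ⟨$⟩ʳ t)) (suc (toℕ k)))
proposition4p1 M _ a b a-inj b-inj a≢b hA hB h₁ h₂ h₃ h₄ i j i∈ j∈ h₅ h₆ =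
  σ , τ , λ k → let k′ = suc (toℕ k) in
    Product.map (push (swapPrefix-≐ a≐ b≐ σ τ k′)) (push (swapPrefix-≐ b≐ a≐ τ σ k′)) (model k)
  where
  σ τ : Permutation′ 4
  σ = transpose i 3F
  τ = transpose j 3F

  open Matroid M using (IsBase)
  open Classify ([ a , b ]′ ∘ splitAt 4) ([,]∘splitAt-injective a b a-inj b-inj a≢b)
  open Preimage classify

  a≐ : ∀ t → a t ≐ₚ α t
  a≐ t = subst (λ s → [ a , b ]′ s ≐ₚ α t) (splitAt-↑ˡ 4 t 4) (g≐ₚsuc (t ↑ˡ 4))
  b≐ : ∀ t → b t ≐ₚ β t
  b≐ t = subst (λ s → [ a , b ]′ s ≐ₚ β t) (splitAt-↑ʳ 4 4 t) (g≐ₚsuc (4 ↑ʳ t))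

  pull : ∀ {S S′} → S ≐ S′ → IsBase S → IsBase (preimage classify S′)
  pull = subst IsBase ∘ ≐⇒≡
  push : ∀ {S S′} → S ≐ S′ → IsBase (preimage classify S′) → IsBase S
  push = subst IsBase ∘ sym ∘ ≐⇒≡

  model : SerialExchange (IsBase ∘ preimage classify) α β σ τ
  model = serialExchange-model (IsBase ∘ preimage classify)
    (pull (image-≐ a≐) hA) (pull (image-≐ b≐) hB)
    (pull (-+-≐ (image-≐ a≐) (a≐ 0F) (b≐ 0F)) h₁) (pull (-+-≐ (image-≐ b≐) (b≐ 0F) (a≐ 0F)) h₂)
    (pull (∪-≐ (firstK-≐ b≐ 2) (∩-≐ (image-≐ a≐) (∁-≐ (firstK-≐ a≐ 2)))) h₃)
    (pull (∪-≐ (firstK-≐ a≐ 2) (∩-≐ (image-≐ b≐) (∁-≐ (firstK-≐ b≐ 2)))) h₄)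
    i∈ j∈
    (pull (-+-≐ (image-≐ a≐) (a≐ i) (b≐ j)) h₅) (pull (-+-≐ (image-≐ b≐) (b≐ j) (a≐ i)) h₆)
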